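{- Let $n\ge 2$ and $D\in\mathcal{D}_{n,1}\cup\mathcal{D}_{n,2}$. For every $S\subseteq V(D)$ with $|S|=2$ and every $r\in S$, $D$ contains $n-2$ pairwise internally disjoint $(S,r)$-trees.
   Context: Digraphs have no loops or parallel arcs. $\overleftrightarrow{K}_n$ is the complete digraph on $n$ vertices. $\mathcal{D}_{n,1}$ (resp. $\mathcal{D}_{n,2}$) is the set of digraphs obtained from $\overleftrightarrow{K}_n$ by deleting an arc set $M$ such that the subdigraph formed by the arcs of $M$ is a union of vertex-disjoint directed cycles (length 2 allowed) covering all $n$ vertices (resp. exactly $n-1$ vertices). An out-tree is an oriented tree in which every vertex except the root has in-degree one. An $(S,r)$-tree is an out-tree in $D$ rooted at $r$ whose vertex set contains $S$. Two $(S,r)$-trees $T_1,T_2$ are internally disjoint if they share no arc and $V(T_1)\cap V(T_2)=S$. -}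

module Defs where

open import Data.Nat using (ℕ; zero; suc; _∸_)
open import Data.Fin using (Fin)
open import Data.Fin.Subset using (Subset; _∈_)
open import Data.Product using (Σ; ∃; _×_; _,_)
open import Data.Sum using (_⊎_)
open import Data.Empty using (⊥)
open import Relation.Nullary using (¬_)
open import Relation.Binary.PropositionalEquality using (_≡_; _≢_)

-- A set M of deleted arcs forming vertex-disjoint directed cycles (length ≥ 2)
-- is encoded by a permutation σ of the vertex set: the arcs of M are the pairs
-- (v , σ v) with σ v ≢ v; the vertices covered by M are exactly the
-- non-fixed points of σ.
Injective : ∀ {n} → (Fin n → Fin n) → Set
Injective σ = ∀ x y → σ x ≡ σ y → x ≡ y

CoversAll : ∀ {n} → (Fin n → Fin n) → Set
CoversAll σ = ∀ v → σ v ≢ v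

CoversAllButOne : ∀ {n} → (Fin n → Fin n) → Set
CoversAllButOne σ = Σ _ λ w → σ w ≡ w × (∀ v → v ≢ w → σ v ≢ v)

MArc : ∀ {n} → (Fin n → Fin n) → Fin n → Fin n → Set
MArc σ u v = σ u ≢ u × σ u ≡ v

Arc : ∀ {n} → (Fin n → Fin n) → Fin n → Fin n → Set
Arc σ u v = u ≢ v × ¬ MArc σ u v

iter : ∀ {A : Set} → (A → A) → ℕ → A → A
iter f zero x = x
iter f (suc k) x = f (iter f k x)

-- An out-tree in D rooted at r: vertex set V, and a parent map p; the arcs are
-- (p v , v) for v ∈ V, v ≢ r.
record OutTree {n} (σ : Fin n → Fin n) (r : Fin n) : Set where
  field
    V      : Subset n
    p      : Fin n → Fin n
    root∈  : r ∈ V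
    par∈   : ∀ v → v ∈ V → v ≢ r → p v ∈ V
    parArc : ∀ v → v ∈ V → v ≢ r → Arc σ (p v) v
    reach  : ∀ v → v ∈ V → ∃ λ k → iter p k v ≡ r

open OutTree public

TArc : ∀ {n} {σ : Fin n → Fin n} {r} → OutTree σ r → Fin n → Fin n → Set
TArc {r = r} T u v = v ∈ V T × v ≢ r × p T v ≡ u

IsSTree : ∀ {n} {σ : Fin n → Fin n} {r} → Fin n → OutTree σ r → Set
IsSTree s T = s ∈ V T

IntDisjoint : ∀ {n} {σ : Fin n → Fin n} {r} → Fin n → OutTree σ r → OutTree σ r → Set
IntDisjoint {r = r} s T₁ T₂ =
  (∀ u v → TArc T₁ u v → TArc T₂ u v → ⊥) ×
  (∀ v → v ∈ V T₁ → v ∈ V T₂ → v ≡ r ⊎ v ≡ s)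

module Submission where

-- The deleted arcs are (v , σ v) for a permutation σ, and only the injectivity
-- of σ matters.  For every vertex
-- w ∉ {r , s} take a path from r to s: the arc r → s if σ r = w; the path
-- r → w → s if σ w ≠ s; otherwise the arc r → s if σ r = r, and the path
-- r → w → σ r → s if not.  Then w is internal only to the path of w, σ r is
-- internal only to the path of the unique w with σ w = s, and the arc r → s is
-- used only by the path of w = σ r or, when σ r = r, of w = σ⁻¹ s.

open import Defs
open import Data.Nat using (ℕ; suc; zero; _≤_; _∸_; s≤s; z≤n)
open import Data.Fin using (Fin; punchIn; punchOut; _≟_)
open import Data.Fin.Properties using (punchInᵢ≢i; punchIn-injective; punchIn-punchOut)
open import Data.Fin.Subset using (_∈_; _∉_; ⁅_⁆; _∪_)
open import Data.Fin.Subset.Properties using (x∈⁅x⁆; x∈⁅y⁆⇒x≡y; x∈p∪q⁺; x∈p∪q⁻)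
open import Data.Product using (Σ; ∃; _×_; _,_; proj₁; proj₂)
open import Data.Sum using (_⊎_; inj₁; inj₂)
open import Data.Empty using (⊥; ⊥-elim)
open import Function using (_∘_)
open import Relation.Nullary using (¬_; yes; no)
open import Relation.Binary.PropositionalEquality
  using (_≡_; _≢_; refl; sym; trans; cong; subst; ≢-sym)

iter-suc : ∀ {A : Set} (f : A → A) k x → iter f (suc k) x ≡ iter f k (f x)
iter-suc f zero    x = refl
iter-suc f (suc k) x = cong f (iter-suc f k x)

module OutTrees {n} (σ : Fin n → Fin n) where

  ¬MArc-image : ∀ {u v} → σ u ≢ v → ¬ MArc σ u v
  ¬MArc-image σu≢v (_ , σu≡v) = σu≢v σu≡v

  ¬MArc-fixed : ∀ {u v} → σ u ≡ u → ¬ MArc σ u v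
  ¬MArc-fixed σu≡u (σu≢u , _) = σu≢u σu≡u

  module _ {r : Fin n} where

    AllVertices : (Fin n → Set) → OutTree σ r → Set
    AllVertices P T = ∀ v → v ∈ V T → P v

    rootTree : OutTree σ r
    rootTree = record
      { V      = ⁅ r ⁆
      ; p      = λ v → v
      ; root∈  = x∈⁅x⁆ r
      ; par∈   = λ v v∈ v≢r → ⊥-elim (v≢r (x∈⁅y⁆⇒x≡y r v∈))
      ; parArc = λ v v∈ v≢r → ⊥-elim (v≢r (x∈⁅y⁆⇒x≡y r v∈))
      ; reach  = λ v v∈ → 0 , x∈⁅y⁆⇒x≡y r v∈
      }

    rootTree-vertices : ∀ {P : Fin n → Set} → P r → AllVertices P rootTree
    rootTree-vertices {P} Pr v v∈ = subst P (sym (x∈⁅y⁆⇒x≡y r v∈)) Pr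

    ∉-rootTree : ∀ {x} → x ≢ r → x ∉ V rootTree
    ∉-rootTree x≢r x∈ = x≢r (x∈⁅y⁆⇒x≡y r x∈)

    module AddLeaf (T : OutTree σ r) {u v : Fin n}
                   (u∈T : u ∈ V T) (v∉T : v ∉ V T) (uv : Arc σ u v) where

      parent : Fin n → Fin n
      parent x with x ≟ v
      ... | yes _ = u
      ... | no  _ = p T x

      parent-leaf : parent v ≡ u
      parent-leaf with v ≟ v
      ... | yes _   = refl
      ... | no  v≢v = ⊥-elim (v≢v refl)

      parent-old : ∀ {x} → x ∈ V T → parent x ≡ p T x
      parent-old {x} x∈T with x ≟ v
      ... | yes refl = ⊥-elim (v∉T x∈T)
      ... | no  _    = refl

      ∈-split : ∀ {x} → x ∈ V T ∪ ⁅ v ⁆ → x ∈ V T ⊎ x ≡ v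
      ∈-split x∈ with x∈p∪q⁻ (V T) ⁅ v ⁆ x∈
      ... | inj₁ x∈T = inj₁ x∈T
      ... | inj₂ x∈v = inj₂ (x∈⁅y⁆⇒x≡y v x∈v)

      reach-step : ∀ j x → iter parent j (parent x) ≡ r → iter parent (suc j) x ≡ r
      reach-step j x = trans (iter-suc parent j x)

      -- p T r is unconstrained, so the walk is cut at its first visit to r; until
      -- then it stays in T, where parent agrees with p T.
      reach-old : ∀ k x → x ∈ V T → iter (p T) k x ≡ r → ∃ λ j → iter parent j x ≡ r
      reach-old k       x x∈T reached with x ≟ r
      reach-old k       x x∈T reached | yes x≡r = 0 , x≡r
      reach-old zero    x x∈T reached | no  x≢r = ⊥-elim (x≢r reached)
      reach-old (suc k) x x∈T reached | no  x≢r =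
        let j , reached′ = reach-old k (p T x) (par∈ T x x∈T x≢r)
                             (trans (sym (iter-suc (p T) k x)) reached)
        in suc j , reach-step j x (trans (cong (iter parent j) (parent-old x∈T)) reached′)

      parent∈T : ∀ x → x ∈ V T ∪ ⁅ v ⁆ → x ≢ r → parent x ∈ V T
      parent∈T x x∈ x≢r with ∈-split x∈
      ... | inj₁ x∈T = subst (_∈ V T) (sym (parent-old x∈T)) (par∈ T x x∈T x≢r)
      ... | inj₂ refl = subst (_∈ V T) (sym parent-leaf) u∈T

      parent-arc : ∀ x → x ∈ V T ∪ ⁅ v ⁆ → x ≢ r → Arc σ (parent x) x
      parent-arc x x∈ x≢r with ∈-split x∈
      ... | inj₁ x∈T = subst (λ y → Arc σ y x) (sym (parent-old x∈T)) (parArc T x x∈T x≢r)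
      ... | inj₂ refl = subst (λ y → Arc σ y v) (sym parent-leaf) uv

      reach-new : ∀ x → x ∈ V T ∪ ⁅ v ⁆ → ∃ λ j → iter parent j x ≡ r
      reach-new x x∈ with ∈-split x∈
      ... | inj₁ x∈T = let k , reached = reach T x x∈T in reach-old k x x∈T reached
      ... | inj₂ refl =
        let k , reached = reach T u u∈T
            j , reached′ = reach-old k u u∈T reached
        in suc j , reach-step j v (trans (cong (iter parent j) parent-leaf) reached′)

      tree : OutTree σ r
      tree = record
        { V      = V T ∪ ⁅ v ⁆
        ; p      = parent
        ; root∈  = x∈p∪q⁺ (inj₁ (root∈ T))
        ; par∈   = λ x x∈ x≢r → x∈p∪q⁺ (inj₁ (parent∈T x x∈ x≢r))
        ; parArc = parent-arc
        ; reach  = reach-new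
        }

      leaf∈ : v ∈ V tree
      leaf∈ = x∈p∪q⁺ (inj₂ (x∈⁅x⁆ v))

      vertices : ∀ {P : Fin n → Set} → AllVertices P T → P v → AllVertices P tree
      vertices all Pv x x∈ with ∈-split x∈
      ... | inj₁ x∈T = all x x∈T
      ... | inj₂ refl = Pv

      ∉-tree : ∀ {x} → x ∉ V T → x ≢ v → x ∉ V tree
      ∉-tree x∉T x≢v x∈ with ∈-split x∈
      ... | inj₁ x∈T = x∉T x∈T
      ... | inj₂ x≡v = x≢v x≡v

    intDisjoint : ∀ {s} (T₁ T₂ : OutTree σ r) →
      (∀ v → v ∈ V T₁ → v ∈ V T₂ → v ≡ r ⊎ v ≡ s) →
      ¬ (p T₁ s ≡ r × p T₂ s ≡ r) → IntDisjoint s T₁ T₂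
    intDisjoint {s} T₁ T₂ common not-both = no-common-arc , common
      where
        -- A shared arc ends in the common non-root vertex s, and its tail is
        -- common to both trees, hence r.
        no-common-arc : ∀ u v → TArc T₁ u v → TArc T₂ u v → ⊥
        no-common-arc u v (v∈₁ , v≢r , p₁v≡u) (v∈₂ , _ , p₂v≡u) with common v v∈₁ v∈₂
        ... | inj₁ v≡r = v≢r v≡r
        ... | inj₂ refl
          with common u (subst (_∈ V T₁) p₁v≡u (par∈ T₁ v v∈₁ v≢r))
                        (subst (_∈ V T₂) p₂v≡u (par∈ T₂ v v∈₂ v≢r))
        ...   | inj₁ u≡r = not-both (trans p₁v≡u u≡r , trans p₂v≡u u≡r)
        ...   | inj₂ u≡v = proj₁ (parArc T₁ v v∈₁ v≢r) (trans p₁v≡u u≡v)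

module TreeFamily {n} (σ : Fin n → Fin n) (σ-injective : Injective σ)
                  (r s : Fin n) (r≢s : r ≢ s) where

  open OutTrees σ

  Internal : Fin n → Fin n → Set
  Internal w v = (v ≡ w × σ r ≢ w) ⊎ (v ≡ σ r × σ w ≡ s)

  UsesArc-rs : Fin n → Set
  UsesArc-rs w = σ r ≡ w ⊎ (σ w ≡ s × σ r ≡ r)

  VertexOf : Fin n → Fin n → Set
  VertexOf w v = v ≡ r ⊎ v ≡ s ⊎ Internal w v

  internal-unique : ∀ {w w′ v} → Internal w v → Internal w′ v → w ≡ w′
  internal-unique (inj₁ (v≡w , _))     (inj₁ (v≡w′ , _))    = trans (sym v≡w) v≡w′
  internal-unique (inj₁ (v≡w , σr≢w))  (inj₂ (v≡σr , _))    = ⊥-elim (σr≢w (trans (sym v≡σr) v≡w))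
  internal-unique (inj₂ (v≡σr , _))    (inj₁ (v≡w′ , σr≢w′)) = ⊥-elim (σr≢w′ (trans (sym v≡σr) v≡w′))
  internal-unique {w} {w′} (inj₂ (_ , σw≡s)) (inj₂ (_ , σw′≡s)) =
    σ-injective w w′ (trans σw≡s (sym σw′≡s))

  usesArc-rs-unique : ∀ {w w′} → w ≢ r → w′ ≢ r → UsesArc-rs w → UsesArc-rs w′ → w ≡ w′
  usesArc-rs-unique _   _    (inj₁ σr≡w)       (inj₁ σr≡w′)       = trans (sym σr≡w) σr≡w′
  usesArc-rs-unique w≢r _    (inj₁ σr≡w)       (inj₂ (_ , σr≡r))  = ⊥-elim (w≢r (trans (sym σr≡w) σr≡r))
  usesArc-rs-unique _   w′≢r (inj₂ (_ , σr≡r)) (inj₁ σr≡w′)       = ⊥-elim (w′≢r (trans (sym σr≡w′) σr≡r))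
  usesArc-rs-unique {w} {w′} _ _ (inj₂ (σw≡s , _)) (inj₂ (σw′≡s , _)) =
    σ-injective w w′ (trans σw≡s (sym σw′≡s))

  record IsTreeFor (w : Fin n) (T : OutTree σ r) : Set where
    field
      s∈       : s ∈ V T
      vertices : AllVertices (VertexOf w) T
      arc-rs   : p T s ≡ r → UsesArc-rs w

  open IsTreeFor

  isTreeFor-disjoint : ∀ {w w′ T T′} → w ≢ r → w′ ≢ r → w ≢ w′ →
    IsTreeFor w T → IsTreeFor w′ T′ → IntDisjoint s T T′
  isTreeFor-disjoint {T = T} {T′} w≢r w′≢r w≢w′ t t′ =
    intDisjoint T T′ common
      (λ (e , e′) → w≢w′ (usesArc-rs-unique w≢r w′≢r (arc-rs t e) (arc-rs t′ e′)))
    where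
      common : ∀ v → v ∈ V T → v ∈ V T′ → v ≡ r ⊎ v ≡ s
      common v v∈ v∈′ with vertices t v v∈ | vertices t′ v v∈′
      ... | inj₁ v≡r        | _                = inj₁ v≡r
      ... | inj₂ (inj₁ v≡s) | _                = inj₂ v≡s
      ... | inj₂ (inj₂ _)   | inj₁ v≡r         = inj₁ v≡r
      ... | inj₂ (inj₂ _)   | inj₂ (inj₁ v≡s)  = inj₂ v≡s
      ... | inj₂ (inj₂ i)   | inj₂ (inj₂ i′)   = ⊥-elim (w≢w′ (internal-unique i i′))

  closePath : ∀ {w u} (T : OutTree σ r) → u ∈ V T → s ∉ V T → Arc σ u s →
    AllVertices (VertexOf w) T → (u ≡ r → UsesArc-rs w) → Σ (OutTree σ r) (IsTreeFor w)
  closePath T u∈T s∉T us all direct = S.tree , record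
    { s∈       = S.leaf∈
    ; vertices = S.vertices all (inj₂ (inj₁ refl))
    ; arc-rs   = direct ∘ trans (sym S.parent-leaf)
    }
    where module S = AddLeaf T u∈T s∉T us

  module RootArc (w : Fin n) (w≢r : w ≢ r) (σr≢w : σ r ≢ w) =
    AddLeaf rootTree (root∈ rootTree) (∉-rootTree w≢r) (≢-sym w≢r , ¬MArc-image σr≢w)

  treeFor : ∀ w → w ≢ r → w ≢ s → Σ (OutTree σ r) (IsTreeFor w)
  treeFor w w≢r w≢s with σ r ≟ w | σ w ≟ s | σ r ≟ r
  ... | yes σr≡w | _ | _ =
    closePath rootTree (root∈ rootTree) (∉-rootTree (≢-sym r≢s))
      (r≢s , ¬MArc-image (w≢s ∘ trans (sym σr≡w)))
      (rootTree-vertices (inj₁ refl)) (λ _ → inj₁ σr≡w)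
  ... | no σr≢w | no σw≢s | _ =
    closePath W.tree W.leaf∈ (W.∉-tree (∉-rootTree (≢-sym r≢s)) (≢-sym w≢s))
      (w≢s , ¬MArc-image σw≢s)
      (W.vertices (rootTree-vertices (inj₁ refl)) (inj₂ (inj₂ (inj₁ (refl , σr≢w)))))
      (⊥-elim ∘ w≢r)
    where module W = RootArc w w≢r σr≢w
  ... | no σr≢w | yes σw≡s | yes σr≡r =
    closePath rootTree (root∈ rootTree) (∉-rootTree (≢-sym r≢s))
      (r≢s , ¬MArc-fixed σr≡r)
      (rootTree-vertices (inj₁ refl)) (λ _ → inj₂ (σw≡s , σr≡r))
  ... | no σr≢w | yes σw≡s | no σr≢r =
    closePath R.tree R.leaf∈ (R.∉-tree (W.∉-tree (∉-rootTree (≢-sym r≢s)) (≢-sym w≢s)) (≢-sym σr≢s))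
      (σr≢s , ¬MArc-image σσr≢s)
      (R.vertices (W.vertices (rootTree-vertices (inj₁ refl)) (inj₂ (inj₂ (inj₁ (refl , σr≢w)))))
                  (inj₂ (inj₂ (inj₂ (refl , σw≡s)))))
      (⊥-elim ∘ σr≢r)
    where
      σw≢σr : σ w ≢ σ r
      σw≢σr = w≢r ∘ σ-injective w r

      σr≢s : σ r ≢ s
      σr≢s = σw≢σr ∘ trans σw≡s ∘ sym

      σσr≢s : σ (σ r) ≢ s
      σσr≢s σσr≡s = σr≢w (σ-injective (σ r) w (trans σσr≡s (sym σw≡s)))

      module W = RootArc w w≢r σr≢w
      module R = AddLeaf W.tree W.leaf∈ (W.∉-tree (∉-rootTree σr≢r) σr≢w)
                         (≢-sym σr≢w , ¬MArc-image σw≢σr)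

module _ {m} {r s : Fin (suc (suc m))} (r≢s : r ≢ s) where

  punchIn₂ : Fin m → Fin (suc (suc m))
  punchIn₂ i = punchIn r (punchIn (punchOut r≢s) i)

  punchIn₂≢r : ∀ i → punchIn₂ i ≢ r
  punchIn₂≢r i = punchInᵢ≢i r _

  punchIn₂≢s : ∀ i → punchIn₂ i ≢ s
  punchIn₂≢s i e = punchInᵢ≢i (punchOut r≢s) i
    (punchIn-injective r _ _ (trans e (sym (punchIn-punchOut r≢s))))

  punchIn₂-injective : ∀ i j → punchIn₂ i ≡ punchIn₂ j → i ≡ j
  punchIn₂-injective i j = punchIn-injective (punchOut r≢s) i j ∘ punchIn-injective r _ _

lemma2p7 : (n : ℕ) → 2 ≤ n → (σ : Fin n → Fin n) → Injective σ →
    (CoversAll σ ⊎ CoversAllButOne σ) →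
    (r s : Fin n) → r ≢ s →
    Σ (Fin (n ∸ 2) → OutTree σ r) λ T →
    (∀ i → IsSTree s (T i)) ×
    (∀ i j → i ≢ j → IntDisjoint s (T i) (T j))
lemma2p7 (suc (suc m)) (s≤s (s≤s z≤n)) σ σ-injective _ r s r≢s =
  proj₁ ∘ tree , IsTreeFor.s∈ ∘ proj₂ ∘ tree ,
  λ i j i≢j → isTreeFor-disjoint (punchIn₂≢r r≢s i) (punchIn₂≢r r≢s j)
                (i≢j ∘ punchIn₂-injective r≢s i j) (proj₂ (tree i)) (proj₂ (tree j))
  where
    open TreeFamily σ σ-injective r s r≢s

    tree : ∀ i → Σ (OutTree σ r) (IsTreeFor (punchIn₂ r≢s i))
    tree i = treeFor (punchIn₂ r≢s i) (punchIn₂≢r r≢s i) (punchIn₂≢s r≢s i)
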